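{- Let $n\geq 3$ and let $u,v$ be distinct vertices of the cycle $C_n$. Then $\frac{n^2+2n+4}{4}\leq f_{C_n}(u,v)\leq\frac{n^2-n+4}{2}$. Moreover, the left equality holds if and only if $d(u,v)=\frac n2$, and the right equality holds if and only if $d(u,v)=1$.
   Context: $f_G(u,v)$ is the number of connected subgraphs of $G$ containing both $u$ and $v$, where a connected subgraph is a nonempty subgraph (vertex subset with a subset of edges among them) that is connected, distinct subgraphs counted separately. $d(u,v)$ is the graph distance. -}

module Defs where

open import Data.Nat using (ℕ; zero; suc; _+_; _*_; _∸_; _≤_)
open import Data.Nat.DivMod using (_%_; m%n<n)
open import Data.Fin using (Fin; toℕ; fromℕ<)
open import Data.Fin.Subset using (Subset; _∈_)
open import Data.Product using (Σ; _×_; _,_; ∃-syntax)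
open import Data.Sum using (_⊎_)
open import Data.List using (List; length)
open import Data.List.Relation.Unary.Unique.Propositional using (Unique)
import Data.List.Membership.Propositional as LM
open import Relation.Binary.PropositionalEquality using (_≡_)
open import Relation.Binary.Construct.Closure.ReflexiveTransitive using (Star)
open import Function.Bundles using (_⇔_)

-- The cycle C_n has vertex set Fin n and, for each i : Fin n, the edge
-- number i joining i and next i (= i + 1 mod n).
next : ∀ {n} → Fin n → Fin n
next {suc m} i = fromℕ< (m%n<n (suc (toℕ i)) (suc m))

EdgeJoins : ∀ {n} → Fin n → Fin n → Fin n → Set
EdgeJoins i x y = (x ≡ i × y ≡ next i) ⊎ (x ≡ next i × y ≡ i)

Adj : ∀ {n} → Fin n → Fin n → Set
Adj {n} x y = Σ (Fin n) λ i → EdgeJoins i x y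

-- A subgraph of C_n: a vertex subset S and an edge subset E (edges indexed by Fin n).
SubG : ℕ → Set
SubG n = Subset n × Subset n

AdjIn : ∀ {n} → Subset n → Fin n → Fin n → Set
AdjIn {n} E x y = Σ (Fin n) λ i → i ∈ E × EdgeJoins i x y

IsConnectedSubgraph : ∀ {n} → SubG n → Set
IsConnectedSubgraph {n} (S , E) =
  (∀ i → i ∈ E → i ∈ S × next i ∈ S)
  × (∃[ x ] x ∈ S)
  × (∀ x y → x ∈ S → y ∈ S → Star (AdjIn E) x y)

ConnSubContaining : ∀ {n} → Fin n → Fin n → SubG n → Set
ConnSubContaining u v G@(S , E) = IsConnectedSubgraph G × u ∈ S × v ∈ S

-- f_{C_n}(u,v) = k : the list L enumerates, without repetition, exactly the
-- connected subgraphs of C_n containing u and v, and has length k.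
Enumerates : ∀ {n} → Fin n → Fin n → List (SubG n) → Set
Enumerates {n} u v L = Unique L × (∀ (G : SubG n) → (G LM.∈ L) ⇔ ConnSubContaining u v G)

data Walk {n : ℕ} : ℕ → Fin n → Fin n → Set where
  here : ∀ {x} → Walk 0 x x
  step : ∀ {m x y z} → Adj x y → Walk m y z → Walk (suc m) x z

IsDistance : ∀ {n} → Fin n → Fin n → ℕ → Set
IsDistance u v d = Walk d u v × (∀ m → Walk m u v → d ≤ m)

-- A connected
-- subgraph of C_n containing u ≠ v is either the whole cycle or misses an edge; in the
-- latter case the missing edges form one run of consecutive edges (two missing edges
-- would cut off the vertices between them), and that run lies on one of the two arcs
-- between u and v. A run of edges on an arc of length k can be chosen in k(k+1)/2 ways,
-- so with k + k' = n and d(u,v) = min(k, k'),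
--   2f = 2 + k(k+1) + k'(k'+1),   4f − (n² + 2n + 4) = (k − k')²,
--   (n² − n + 4) − 2f = 2(k − 1)(k' − 1),
-- which gives both bounds and their equality cases.
module Submission where

open import Defs
open import Data.Empty using (⊥; ⊥-elim)
open import Data.Fin using (Fin; toℕ; fromℕ<)
open import Data.Fin.Properties using (toℕ-fromℕ<; toℕ-injective; toℕ<n; all?; ¬∀⟶∃¬)
open import Data.Fin.Subset using (Subset; _∈_; _∉_; _⊆_; ⊤)
open import Data.Fin.Subset.Properties using (_∈?_; ∈⊤; ⊆-antisym)
open import Data.List using (List; []; _∷_; _++_; map; upTo; length)
open import Data.List.Membership.Propositional as List using ()
open import Data.List.Membership.Propositional.Properties
  using (∈-map⁺; ∈-map⁻; ∈-++⁺ˡ; ∈-++⁺ʳ; ∈-++⁻; ∈-upTo⁺; ∈-upTo⁻)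
open import Data.List.Membership.Propositional.Properties.WithK using (unique∧set⇒bag)
open import Data.List.Properties using (length-++; length-map; length-upTo)
open import Data.List.Relation.Binary.BagAndSetEquality using (∼bag⇒↭)
open import Data.List.Relation.Binary.Permutation.Propositional.Properties using (↭-length)
open import Data.List.Relation.Unary.All as All using ()
open import Data.List.Relation.Unary.All.Properties as All using ()
open import Data.List.Relation.Unary.Any using (here; there)
open import Data.List.Relation.Unary.Unique.Propositional using (Unique; []; _∷_)
open import Data.List.Relation.Unary.Unique.Propositional.Properties as Unique using ()
open import Data.Nat using (ℕ; zero; suc; _+_; _*_; _∸_; _⊓_; _≤_; _<_; _≤?_; _<?_; z≤n; s≤s; s≤s⁻¹; NonZero)
open import Data.Nat.Properties
open import Data.Nat.DivMod using (_%_; m%n<n; m<n⇒m%n≡m; [m+n]%n≡m%n; %-distribˡ-+; m%n%n≡m%n; %-remove-+ˡ; n%n≡0)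
open import Data.Nat.Divisibility using (∣-refl)
open import Data.Nat.Tactic.RingSolver using (solve-∀)
open import Data.Product using (_×_; _,_; proj₁; proj₂; map₂; ∃-syntax; ∃₂; uncurry)
open import Data.Sum using (_⊎_; inj₁; inj₂; [_,_])
open import Data.Vec using (tabulate)
open import Data.Vec.Properties using (lookup∘tabulate; []=⇒lookup; lookup⇒[]=)
open import Function using (_∘_; id)
open import Function.Bundles using (_⇔_; mk⇔; Equivalence)
import Function.Properties.Equivalence as ⇔
open import Relation.Binary.Construct.Closure.ReflexiveTransitive using (Star; ε; _◅_; _◅◅_; fold; reverse)
open import Relation.Binary.PropositionalEquality hiding ([_])
open import Relation.Nullary using (¬_; Dec; yes; no; does; ¬?; _×-dec_)
open import Relation.Nullary.Decidable using (dec-true; decidable-stable)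
open import Level using (0ℓ)
open import Relation.Unary using (Pred; Decidable)

open Equivalence using (to; from)

_∈[_,_] : ℕ → ℕ → ℕ → Set
t ∈[ p , q ] = p ≤ t × t ≤ q

_∈[_,_]? : ∀ t p q → Dec (t ∈[ p , q ])
t ∈[ p , q ]? = p ≤? t ×-dec t ≤? q

∈[]-injective : ∀ {p q p′ q′} → p ≤ q → p′ ≤ q′
  → (∀ {t} → t ∈[ p , q ] → t ∈[ p′ , q′ ]) → (∀ {t} → t ∈[ p′ , q′ ] → t ∈[ p , q ])
  → p ≡ p′ × q ≡ q′
∈[]-injective p≤q p′≤q′ ⊆′ ⊇′ =
  ≤-antisym (proj₁ (⊇′ (≤-refl , p′≤q′))) (proj₁ (⊆′ (≤-refl , p≤q))) ,
  ≤-antisym (proj₂ (⊆′ (p≤q , ≤-refl))) (proj₂ (⊇′ (p′≤q′ , ≤-refl)))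

module _ {M : ℕ → Set} (M? : Decidable M) where

  private
    least-below : ∀ B → (∃[ p ] M p × (∀ {s} → M s → p ≤ s)) ⊎ (∀ {s} → s < B → ¬ M s)
    least-below zero = inj₂ λ ()
    least-below (suc B) with least-below B | M? B
    ... | inj₁ found | _ = inj₁ found
    ... | inj₂ none | yes MB = inj₁ (B , MB , λ Ms → ≮⇒≥ λ s<B → none s<B Ms)
    ... | inj₂ none | no ¬MB = inj₂ λ s<1+B → [ none , (λ { refl → ¬MB }) ] (m<1+n⇒m<n∨m≡n s<1+B)

  least : ∀ {t} → M t → ∃[ p ] M p × (∀ {s} → M s → p ≤ s)
  least {t} Mt with least-below (suc t)
  ... | inj₁ found = found
  ... | inj₂ none = ⊥-elim (none ≤-refl Mt)

  greatest : ∀ K → (∀ {s} → M s → s < K) → ∀ {t} → M t → ∃[ q ] M q × (∀ {s} → M s → s ≤ q)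
  greatest zero bounded Mt = ⊥-elim (n≮0 (bounded Mt))
  greatest (suc K) bounded Mt with M? K
  ... | yes MK = K , MK , s≤s⁻¹ ∘ bounded
  ... | no ¬MK = greatest K (λ Ms → ≤∧≢⇒< (s≤s⁻¹ (bounded Ms)) λ { refl → ¬MK Ms }) Mt

  convex⇒interval : ∀ K → (∀ {s} → M s → s < K) → (∀ {r s t} → r < s → s < t → M r → M t → M s)
    → ∀ {t} → M t → ∃₂ λ p q → p ≤ q × (∀ s → M s ⇔ s ∈[ p , q ])
  convex⇒interval K bounded convex Mt with least Mt | greatest K bounded Mt
  ... | p , Mp , p-least | q , Mq , q-greatest =
    p , q , p-least Mq , λ s → mk⇔ (λ Ms → p-least Ms , q-greatest Ms) inside
    where
    inside : ∀ {s} → s ∈[ p , q ] → M s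
    inside (p≤s , s≤q) with m≤n⇒m<n∨m≡n p≤s | m≤n⇒m<n∨m≡n s≤q
    ... | inj₂ refl | _ = Mp
    ... | inj₁ _ | inj₂ refl = Mq
    ... | inj₁ p<s | inj₁ s<q = convex p<s s<q Mp Mq

orderedPairs : ℕ → List (ℕ × ℕ)
orderedPairs zero = []
orderedPairs (suc K) = orderedPairs K ++ map (_, K) (upTo (suc K))

∈-orderedPairs⁺ : ∀ {K p q} → p ≤ q → q < K → (p , q) List.∈ orderedPairs K
∈-orderedPairs⁺ {suc K} p≤q q<1+K with m<1+n⇒m<n∨m≡n q<1+K
... | inj₁ q<K = ∈-++⁺ˡ (∈-orderedPairs⁺ p≤q q<K)
... | inj₂ refl = ∈-++⁺ʳ (orderedPairs K) (∈-map⁺ (_, K) (∈-upTo⁺ (s≤s p≤q)))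

∈-orderedPairs⁻ : ∀ {K p q} → (p , q) List.∈ orderedPairs K → p ≤ q × q < K
∈-orderedPairs⁻ {suc K} pq∈ with ∈-++⁻ (orderedPairs K) pq∈
... | inj₁ pq∈′ = map₂ m<n⇒m<1+n (∈-orderedPairs⁻ pq∈′)
... | inj₂ pq∈′ with ∈-map⁻ (_, K) pq∈′
...   | p , p∈ , refl = s≤s⁻¹ (∈-upTo⁻ p∈) , ≤-refl

orderedPairs-unique : ∀ K → Unique (orderedPairs K)
orderedPairs-unique zero = []
orderedPairs-unique (suc K) =
  Unique.++⁺ (orderedPairs-unique K) (Unique.map⁺ (cong proj₁) (Unique.upTo⁺ (suc K))) disjoint
  where
  disjoint : ∀ {x} → ¬ (x List.∈ orderedPairs K × x List.∈ map (_, K) (upTo (suc K)))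
  disjoint (x∈old , x∈new) with ∈-map⁻ (_, K) x∈new
  ... | _ , _ , refl = <-irrefl refl (proj₂ (∈-orderedPairs⁻ x∈old))

length-orderedPairs : ∀ K → 2 * length (orderedPairs K) ≡ K * suc K
length-orderedPairs zero = refl
length-orderedPairs (suc K) = begin
  2 * length (orderedPairs K ++ map (_, K) (upTo (suc K)))
    ≡⟨ cong (2 *_) (trans (length-++ (orderedPairs K)) (cong (length (orderedPairs K) +_) lengthNew)) ⟩
  2 * (length (orderedPairs K) + suc K) ≡⟨ *-distribˡ-+ 2 (length (orderedPairs K)) (suc K) ⟩
  2 * length (orderedPairs K) + 2 * suc K ≡⟨ cong (_+ 2 * suc K) (length-orderedPairs K) ⟩
  K * suc K + 2 * suc K ≡⟨ grow K ⟩
  suc K * suc (suc K) ∎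
  where
  open ≡-Reasoning
  grow : ∀ K → K * suc K + 2 * suc K ≡ suc K * suc (suc K)
  grow = solve-∀
  lengthNew : length (map (_, K) (upTo (suc K))) ≡ suc K
  lengthNew = trans (length-map (_, K) (upTo (suc K))) (length-upTo (suc K))

map⁺-injectiveOn : ∀ {A B : Set} {f : A → B} {xs}
  → (∀ {x y} → x List.∈ xs → y List.∈ xs → f x ≡ f y → x ≡ y) → Unique xs → Unique (map f xs)
map⁺-injectiveOn _ [] = []
map⁺-injectiveOn inj (x∉xs ∷ xs-unique) =
  All.map⁺ (All.tabulate λ y∈xs fx≡fy → All.lookup x∉xs y∈xs (inj (here refl) (there y∈xs) fx≡fy))
  ∷ map⁺-injectiveOn (λ x∈ y∈ → inj (there x∈) (there y∈)) xs-unique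

unique⇒length≡ : ∀ {A : Set} {xs ys : List A} → Unique xs → Unique ys
  → (∀ {z} → z List.∈ xs ⇔ z List.∈ ys) → length xs ≡ length ys
unique⇒length≡ xs-unique ys-unique same = ↭-length (∼bag⇒↭ (unique∧set⇒bag xs-unique ys-unique same))

select : ∀ {n} {P : Pred (Fin n) 0ℓ} → Decidable P → Subset n
select P? = tabulate (does ∘ P?)

∈-select : ∀ {n} {P : Pred (Fin n) 0ℓ} (P? : Decidable P) {x} → x ∈ select P? ⇔ P x
∈-select {P = P} P? {x} = mk⇔ selected (λ Px → lookup⇒[]= x _ (trans (lookup∘tabulate (does ∘ P?) x) (dec-true (P? x) Px)))
  where
  selected : x ∈ select P? → P x
  selected x∈ with P? x | trans (sym (lookup∘tabulate (does ∘ P?) x)) ([]=⇒lookup x∈)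
  ... | yes Px | _ = Px
  ... | no _ | ()

preserved-along : ∀ {A : Set} {R : A → A → Set} {P : A → Set}
  → (∀ {x y} → R x y → P x → P y) → ∀ {x y} → Star R x y → P x → P y
preserved-along {P = P} preserve = fold (λ x y → P x → P y) (λ r continue → continue ∘ preserve r) id

m+n≡m⇔n≡0 : ∀ m n → m + n ≡ m ⇔ n ≡ 0
m+n≡m⇔n≡0 m n = mk⇔ (λ eq → +-cancelˡ-≡ m n 0 (trans eq (sym (+-identityʳ m)))) λ { refl → +-identityʳ m }

[m%d+n]%d≡[m+n]%d : ∀ m n d .{{_ : NonZero d}} → (m % d + n) % d ≡ (m + n) % d
[m%d+n]%d≡[m+n]%d m n d = begin
  (m % d + n) % d       ≡⟨ %-distribˡ-+ (m % d) n d ⟩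
  (m % d % d + n % d) % d ≡⟨ cong (λ z → (z + n % d) % d) (m%n%n≡m%n m d) ⟩
  (m % d + n % d) % d   ≡⟨ %-distribˡ-+ m n d ⟨
  (m + n) % d           ∎
  where open ≡-Reasoning

[m+n%d]%d≡[m+n]%d : ∀ m n d .{{_ : NonZero d}} → (m + n % d) % d ≡ (m + n) % d
[m+n%d]%d≡[m+n]%d m n d = begin
  (m + n % d) % d ≡⟨ cong (_% d) (+-comm m (n % d)) ⟩
  (n % d + m) % d ≡⟨ [m%d+n]%d≡[m+n]%d n m d ⟩
  (n + m) % d     ≡⟨ cong (_% d) (+-comm n m) ⟩
  (m + n) % d     ∎
  where open ≡-Reasoning

[m+n]%d-cases : ∀ {m n d} .{{_ : NonZero d}} → m < d → n < d
  → (m + n) % d ≡ m + n ⊎ (m + n) % d + d ≡ m + n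
[m+n]%d-cases {m} {n} {d} m<d n<d with m + n <? d
... | yes m+n<d = inj₁ (m<n⇒m%n≡m m+n<d)
... | no m+n≮d = inj₂ (begin
  (m + n) % d + d       ≡⟨ cong (λ z → z % d + d) (sym wrapped) ⟩
  (r + d) % d + d       ≡⟨ cong (_+ d) (trans ([m+n]%n≡m%n r d) (m<n⇒m%n≡m r<d)) ⟩
  r + d                 ≡⟨ wrapped ⟩
  m + n                 ∎)
  where
  open ≡-Reasoning
  r : ℕ
  r = m + n ∸ d
  wrapped : r + d ≡ m + n
  wrapped = m∸n+n≡m (≮⇒≥ m+n≮d)
  r<d : r < d
  r<d = +-cancelʳ-< d r d (subst (_< d + d) (sym wrapped) (+-mono-< m<d n<d))

CountBounds : ℕ → ℕ → ℕ → Set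
CountBounds n F d =
  (n * n + 2 * n + 4 ≤ 4 * F)
  × (2 * F ≤ n * n ∸ n + 4)
  × ((4 * F ≡ n * n + 2 * n + 4) ⇔ (2 * d ≡ n))
  × ((2 * F ≡ n * n ∸ n + 4) ⇔ (d ≡ 1))

excess-square : ∀ {x X g} → x ≡ X + g * g → (x ≡ X) ⇔ (g ≡ 0)
excess-square {x} {X} {g} x≡ = mk⇔
  (λ x≡X → [ id , id ] (m*n≡0⇒m≡0∨n≡0 g (to (m+n≡m⇔n≡0 X (g * g)) (trans (sym x≡) x≡X))))
  (λ { refl → trans x≡ (+-identityʳ X) })

deficit-product : ∀ {x Y a b} → Y ≡ x + 2 * a * b → (x ≡ Y) ⇔ (a ≡ 0 ⊎ b ≡ 0)
deficit-product {x} {Y} {a} {b} Y≡ = mk⇔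
  (λ x≡Y → [ inj₁ ∘ m*n≡0⇒m≡0 a 2 ∘ trans (*-comm a 2) , inj₂ ]
             (m*n≡0⇒m≡0∨n≡0 (2 * a) (to (m+n≡m⇔n≡0 x _) (sym (trans x≡Y Y≡)))))
  λ { (inj₁ refl) → sym (trans Y≡ (+-identityʳ x))
    ; (inj₂ refl) → sym (trans Y≡ (trans (cong (x +_) (*-zeroʳ (2 * a))) (+-identityʳ x))) }

four-times-count : ∀ d g {F} → 2 * F ≡ 2 + (d * suc d + (d + g) * suc (d + g))
  → 4 * F ≡ (d + (d + g)) * (d + (d + g)) + 2 * (d + (d + g)) + 4 + g * g
four-times-count d g {F} twoF = begin
  4 * F                                         ≡⟨ double-twice F ⟩
  2 * (2 * F)                                   ≡⟨ cong (2 *_) twoF ⟩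
  2 * (2 + (d * suc d + (d + g) * suc (d + g))) ≡⟨ expand d g ⟩
  (d + (d + g)) * (d + (d + g)) + 2 * (d + (d + g)) + 4 + g * g ∎
  where
  open ≡-Reasoning
  double-twice : ∀ F → 4 * F ≡ 2 * (2 * F)
  double-twice = solve-∀
  expand : ∀ d g → 2 * (2 + (d * suc d + (d + g) * suc (d + g)))
                   ≡ (d + (d + g)) * (d + (d + g)) + 2 * (d + (d + g)) + 4 + g * g
  expand = solve-∀

twice-count : ∀ a b {F} → 2 * F ≡ 2 + (suc a * suc (suc a) + suc b * suc (suc b))
  → (suc a + suc b) * (suc a + suc b) ∸ (suc a + suc b) + 4 ≡ 2 * F + 2 * a * b
twice-count a b {F} twoF = begin
  n * n ∸ n + 4                                               ≡⟨ cong (_+ 4) (m+n∸m≡n n ((a + suc b) * n)) ⟩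
  (a + suc b) * suc (a + suc b) + 4                           ≡⟨ expand a b ⟩
  2 + (suc a * suc (suc a) + suc b * suc (suc b)) + 2 * a * b ≡⟨ cong (_+ 2 * a * b) (sym twoF) ⟩
  2 * F + 2 * a * b                                           ∎
  where
  open ≡-Reasoning
  n : ℕ
  n = suc a + suc b
  expand : ∀ a b → (a + suc b) * suc (a + suc b) + 4 ≡ 2 + (suc a * suc (suc a) + suc b * suc (suc b)) + 2 * a * b
  expand = solve-∀

count-bounds-ordered : ∀ {d e F} → 1 ≤ d → d ≤ e → 2 * F ≡ 2 + (d * suc d + e * suc e) → CountBounds (d + e) F d
count-bounds-ordered {suc a} {F = F} (s≤s z≤n) d≤e twoF with m≤n⇒∃[o]m+o≡n d≤e
... | g , refl =
  subst (X ≤_) (sym lower) (m≤m+n X (g * g)) ,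
  subst (2 * F ≤_) (sym upper) (m≤m+n (2 * F) (2 * a * (a + g))) ,
  ⇔.trans (excess-square lower) (mk⇔ (λ { refl → refl }) balanced) ,
  ⇔.trans (deficit-product upper) (mk⇔ [ cong suc , cong suc ∘ m+n≡0⇒m≡0 a ] λ { refl → inj₁ refl })
  where
  n X : ℕ
  n = suc a + (suc a + g)
  X = n * n + 2 * n + 4
  lower : 4 * F ≡ X + g * g
  lower = four-times-count (suc a) g {F} twoF
  upper : n * n ∸ n + 4 ≡ 2 * F + 2 * a * (a + g)
  upper = twice-count a (a + g) {F} twoF
  balanced : 2 * suc a ≡ n → g ≡ 0
  balanced eq = sym (+-cancelˡ-≡ (suc a) 0 g (+-cancelˡ-≡ (suc a) (suc a + 0) (suc a + g) eq))

count-bounds : ∀ {k k′ F d} → 1 ≤ k → 1 ≤ k′ → d ≡ k ⊓ k′ → 2 * F ≡ 2 + (k * suc k + k′ * suc k′)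
  → CountBounds (k + k′) F d
count-bounds {k} {k′} {F} 1≤k 1≤k′ refl twoF with ≤-total k k′
... | inj₁ k≤k′ = subst (CountBounds (k + k′) F) (sym (m≤n⇒m⊓n≡m k≤k′))
                    (count-bounds-ordered {F = F} 1≤k k≤k′ twoF)
... | inj₂ k′≤k = subst₂ (λ n d → CountBounds n F d) (+-comm k′ k) (sym (m≥n⇒m⊓n≡n k′≤k))
                    (count-bounds-ordered {F = F} 1≤k′ k′≤k (trans twoF (cong (2 +_) (+-comm (k * suc k) _))))

-- The cycle C_n with n = suc m

module Cycle (m : ℕ) where

  N : ℕ
  N = suc m

  opaque
    offset : Fin N → Fin N → ℕ
    offset c x = (toℕ x + (N ∸ toℕ c)) % N

    shift : Fin N → ℕ → Fin N
    shift c t = fromℕ< (m%n<n (t + toℕ c) N)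

    offset<N : ∀ c x → offset c x < N
    offset<N c x = m%n<n (toℕ x + (N ∸ toℕ c)) N

    private
      c+[N∸c]≡N : ∀ (c : Fin N) → toℕ c + (N ∸ toℕ c) ≡ N
      c+[N∸c]≡N c = m+[n∸m]≡n (<⇒≤ (toℕ<n c))

      toℕ-shift : ∀ c t → toℕ (shift c t) ≡ (t + toℕ c) % N
      toℕ-shift c t = toℕ-fromℕ< (m%n<n (t + toℕ c) N)

      toℕ-next : ∀ (x : Fin N) → toℕ (next x) ≡ suc (toℕ x) % N
      toℕ-next x = toℕ-fromℕ< (m%n<n (suc (toℕ x)) N)

    offset-shift : ∀ c {t} → t < N → offset c (shift c t) ≡ t
    offset-shift c {t} t<N = begin
      (toℕ (shift c t) + (N ∸ toℕ c)) % N ≡⟨ cong (λ z → (z + (N ∸ toℕ c)) % N) (toℕ-shift c t) ⟩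
      ((t + toℕ c) % N + (N ∸ toℕ c)) % N ≡⟨ [m%d+n]%d≡[m+n]%d (t + toℕ c) _ N ⟩
      (t + toℕ c + (N ∸ toℕ c)) % N       ≡⟨ cong (_% N) (trans (+-assoc t _ _) (cong (t +_) (c+[N∸c]≡N c))) ⟩
      (t + N) % N                         ≡⟨ [m+n]%n≡m%n t N ⟩
      t % N                               ≡⟨ m<n⇒m%n≡m t<N ⟩
      t                                   ∎
      where open ≡-Reasoning

    shift-offset : ∀ c x → shift c (offset c x) ≡ x
    shift-offset c x = toℕ-injective (begin
      toℕ (shift c (offset c x))                ≡⟨ toℕ-shift c (offset c x) ⟩
      ((toℕ x + (N ∸ toℕ c)) % N + toℕ c) % N   ≡⟨ [m%d+n]%d≡[m+n]%d (toℕ x + (N ∸ toℕ c)) (toℕ c) N ⟩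
      (toℕ x + (N ∸ toℕ c) + toℕ c) % N         ≡⟨ cong (_% N) (+-assoc (toℕ x) _ (toℕ c)) ⟩
      (toℕ x + ((N ∸ toℕ c) + toℕ c)) % N       ≡⟨ cong (λ z → (toℕ x + z) % N) (m∸n+n≡m (<⇒≤ (toℕ<n c))) ⟩
      (toℕ x + N) % N                           ≡⟨ [m+n]%n≡m%n (toℕ x) N ⟩
      toℕ x % N                                 ≡⟨ m<n⇒m%n≡m (toℕ<n x) ⟩
      toℕ x                                     ∎)
      where open ≡-Reasoning

    next-shift : ∀ c t → next (shift c t) ≡ shift c (suc t)
    next-shift c t = toℕ-injective (begin
      toℕ (next (shift c t))  ≡⟨ toℕ-next (shift c t) ⟩
      suc (toℕ (shift c t)) % N ≡⟨ cong (λ z → suc z % N) (toℕ-shift c t) ⟩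
      (1 + (t + toℕ c) % N) % N ≡⟨ [m+n%d]%d≡[m+n]%d 1 (t + toℕ c) N ⟩
      suc (t + toℕ c) % N     ≡⟨ toℕ-shift c (suc t) ⟨
      toℕ (shift c (suc t))   ∎)
      where open ≡-Reasoning

    shift-zero : ∀ c → shift c 0 ≡ c
    shift-zero c = toℕ-injective (trans (toℕ-shift c 0) (m<n⇒m%n≡m (toℕ<n c)))

    shift-N : ∀ c → shift c N ≡ c
    shift-N c = toℕ-injective (trans (toℕ-shift c N) (trans (%-remove-+ˡ (toℕ c) ∣-refl) (m<n⇒m%n≡m (toℕ<n c))))

    offset-self : ∀ c → offset c c ≡ 0
    offset-self c = trans (cong (_% N) (c+[N∸c]≡N c)) (n%n≡0 N)

    offset-cocycle : ∀ c w x → offset c x ≡ (offset w x + offset c w) % N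
    offset-cocycle c w x = sym (begin
      ((toℕ x + (N ∸ toℕ w)) % N + (toℕ w + (N ∸ toℕ c)) % N) % N
        ≡⟨ %-distribˡ-+ (toℕ x + (N ∸ toℕ w)) (toℕ w + (N ∸ toℕ c)) N ⟨
      (toℕ x + (N ∸ toℕ w) + (toℕ w + (N ∸ toℕ c))) % N
        ≡⟨ cong (_% N) (regroup (toℕ x) (N ∸ toℕ w) (toℕ w) (N ∸ toℕ c)) ⟩
      (toℕ x + (N ∸ toℕ c) + (N ∸ toℕ w + toℕ w)) % N
        ≡⟨ cong (λ z → (toℕ x + (N ∸ toℕ c) + z) % N) (m∸n+n≡m (<⇒≤ (toℕ<n w))) ⟩
      (toℕ x + (N ∸ toℕ c) + N) % N
        ≡⟨ [m+n]%n≡m%n (toℕ x + (N ∸ toℕ c)) N ⟩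
      (toℕ x + (N ∸ toℕ c)) % N ∎)
      where
      open ≡-Reasoning
      regroup : ∀ a b c d → a + b + (c + d) ≡ a + d + (b + c)
      regroup = solve-∀

  offset-injective : ∀ c {x y} → offset c x ≡ offset c y → x ≡ y
  offset-injective c {x} {y} eq = trans (sym (shift-offset c x)) (trans (cong (shift c) eq) (shift-offset c y))

  offset≡0⇒≡ : ∀ {c x} → offset c x ≡ 0 → x ≡ c
  offset≡0⇒≡ {c} eq = offset-injective c (trans eq (sym (offset-self c)))

  next≡shift : ∀ c x → next x ≡ shift c (suc (offset c x))
  next≡shift c x = trans (cong next (sym (shift-offset c x))) (next-shift c (offset c x))

  offset-next : ∀ c x → offset c (next x) ≡ suc (offset c x) ⊎ (suc (offset c x) ≡ N × offset c (next x) ≡ 0)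
  offset-next c x with m≤n⇒m<n∨m≡n (offset<N c x)
  ... | inj₁ 1+o<N = inj₁ (trans (cong (offset c) (next≡shift c x)) (offset-shift c 1+o<N))
  ... | inj₂ 1+o≡N = inj₂ (1+o≡N , trans (cong (offset c) next≡c) (offset-self c))
    where
    next≡c : next x ≡ c
    next≡c = trans (next≡shift c x) (trans (cong (shift c) 1+o≡N) (shift-N c))

  offset-via : ∀ c w x → offset w x + offset c w ≡ offset c x ⊎ offset w x + offset c w ≡ offset c x + N
  offset-via c w x with [m+n]%d-cases (offset<N w x) (offset<N c w)
  ... | inj₁ no-wrap = inj₁ (trans (sym no-wrap) (sym (offset-cocycle c w x)))
  ... | inj₂ wrap = inj₂ (trans (sym wrap) (cong (_+ N) (sym (offset-cocycle c w x))))

  offset-sum : ∀ {c w} → c ≢ w → offset c w + offset w c ≡ N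
  offset-sum {c} {w} c≢w with offset-via c w c
  ... | inj₁ sum≡0 = ⊥-elim (c≢w (sym (offset≡0⇒≡ (m+n≡0⇒n≡0 (offset w c) (trans sum≡0 (offset-self c))))))
  ... | inj₂ sum≡N = trans (+-comm (offset c w) _) (trans sum≡N (cong (_+ N) (offset-self c)))

  offset-pos : ∀ {c w} → c ≢ w → 1 ≤ offset c w
  offset-pos {c} {w} c≢w with offset c w in eq
  ... | zero = ⊥-elim (c≢w (sym (offset≡0⇒≡ eq)))
  ... | suc _ = s≤s z≤n

  opposite-arcs-disjoint : ∀ {c w x} → c ≢ w → offset c x < offset c w → offset w x < offset w c → ⊥
  opposite-arcs-disjoint {c} {w} {x} c≢w x<w x<c with offset-via c w x
  ... | inj₁ eq = <⇒≱ x<w (≤-trans (m≤n+m (offset c w) (offset w x)) (≤-reflexive eq))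
  ... | inj₂ eq = <⇒≱ (+-monoˡ-< (offset c w) x<c) (begin
    offset w c + offset c w ≡⟨ +-comm (offset w c) _ ⟩
    offset c w + offset w c ≡⟨ offset-sum c≢w ⟩
    N                       ≤⟨ m≤n+m N (offset c x) ⟩
    offset c x + N          ≡⟨ eq ⟨
    offset w x + offset c w ∎)
    where open ≤-Reasoning

  other-arc : ∀ {c w x} → c ≢ w → offset c w ≤ offset c x → offset w x < offset w c
  other-arc {c} {w} {x} c≢w w≤x with offset-via c w x
  ... | inj₁ eq = +-cancelʳ-< (offset c w) _ _ (begin-strict
    offset w x + offset c w ≡⟨ eq ⟩
    offset c x              <⟨ offset<N c x ⟩
    N                       ≡⟨ offset-sum c≢w ⟨
    offset c w + offset w c ≡⟨ +-comm (offset c w) _ ⟩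
    offset w c + offset c w ∎)
    where open ≤-Reasoning
  ... | inj₂ eq = ⊥-elim (<⇒≱ (+-cancelʳ-< N _ _ (begin-strict
    offset c x + N          ≡⟨ eq ⟨
    offset w x + offset c w <⟨ +-monoˡ-< (offset c w) (offset<N w x) ⟩
    N + offset c w          ≡⟨ +-comm N _ ⟩
    offset c w + N          ∎)) w≤x)
    where open ≤-Reasoning

  -- Walks and distance

  walk-bound : ∀ {j x y} → Walk j x y → offset y x ≤ j ⊎ N ≤ offset y x + j
  walk-bound {x = x} here = inj₁ (≤-reflexive (offset-self x))
  walk-bound {y = y} (step (i , inj₁ (refl , refl)) w) = forward (offset-next y i) (walk-bound w)
    where
    forward : ∀ {s s′ j} → s′ ≡ suc s ⊎ (suc s ≡ N × s′ ≡ 0)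
      → s′ ≤ j ⊎ N ≤ s′ + j → s ≤ suc j ⊎ N ≤ s + suc j
    forward {s} {j = j} (inj₁ refl) (inj₁ 1+s≤j) = inj₁ (m≤n⇒m≤1+n (<⇒≤ 1+s≤j))
    forward {s} {j = j} (inj₁ refl) (inj₂ N≤) = inj₂ (subst (N ≤_) (sym (+-suc s j)) N≤)
    forward {s} {j = j} (inj₂ (1+s≡N , _)) _ = inj₂ (subst₂ _≤_ 1+s≡N (sym (+-suc s j)) (s≤s (m≤m+n s j)))
  walk-bound {y = y} (step (i , inj₂ (refl , refl)) w) = backward (offset-next y i) (walk-bound w)
    where
    backward : ∀ {s s′ j} → s ≡ suc s′ ⊎ (suc s′ ≡ N × s ≡ 0)
      → s′ ≤ j ⊎ N ≤ s′ + j → s ≤ suc j ⊎ N ≤ s + suc j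
    backward (inj₁ refl) (inj₁ s′≤j) = inj₁ (s≤s s′≤j)
    backward {s′ = s′} {j} (inj₁ refl) (inj₂ N≤) = inj₂ (≤-trans N≤ (+-mono-≤ (n≤1+n s′) (n≤1+n j)))
    backward (inj₂ (_ , refl)) _ = inj₁ z≤n

  forward-walk : ∀ c a t → Walk t (shift c a) (shift c (a + t))
  forward-walk c a zero = subst (Walk 0 (shift c a) ∘ shift c) (sym (+-identityʳ a)) here
  forward-walk c a (suc t) =
    step (shift c a , inj₁ (refl , sym (next-shift c a)))
         (subst (Walk t (shift c (suc a)) ∘ shift c) (sym (+-suc a t)) (forward-walk c (suc a) t))

  backward-walk : ∀ c t → Walk t (shift c t) (shift c 0)
  backward-walk c zero = here
  backward-walk c (suc t) = step (shift c t , inj₂ (sym (next-shift c t) , refl)) (backward-walk c t)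

  distance≡min : ∀ {u v d} → u ≢ v → IsDistance u v d → d ≡ offset u v ⊓ offset v u
  distance≡min {u} {v} {d} u≢v (walk , shortest) =
    ≤-antisym (⊓-glb (shortest _ clockwise) (shortest _ anticlockwise)) (lower (walk-bound walk))
    where
    clockwise : Walk (offset u v) u v
    clockwise = subst₂ (Walk _) (shift-zero u) (shift-offset u v) (forward-walk u 0 (offset u v))
    anticlockwise : Walk (offset v u) u v
    anticlockwise = subst₂ (Walk _) (shift-offset v u) (shift-zero v) (backward-walk v (offset v u))
    lower : offset v u ≤ d ⊎ N ≤ offset v u + d → offset u v ⊓ offset v u ≤ d
    lower (inj₁ k′≤d) = ≤-trans (m⊓n≤n _ _) k′≤d
    lower (inj₂ N≤k′+d) = ≤-trans (m⊓n≤m _ _) (+-cancelˡ-≤ (offset v u) _ _ (subst (_≤ offset v u + d) N≡ N≤k′+d))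
      where
      N≡ : N ≡ offset v u + offset u v
      N≡ = trans (sym (offset-sum u≢v)) (+-comm (offset u v) _)

  -- Connected subgraphs

  AdjIn-sym : ∀ {E : Subset N} {x y} → AdjIn E x y → AdjIn E y x
  AdjIn-sym (i , i∈E , inj₁ (x≡i , y≡next)) = i , i∈E , inj₂ (y≡next , x≡i)
  AdjIn-sym (i , i∈E , inj₂ (x≡next , y≡i)) = i , i∈E , inj₁ (y≡i , x≡next)

  arc-path : ∀ {E} c a t → (∀ {i} → i < t → shift c (a + i) ∈ E) → Star (AdjIn E) (shift c (a + t)) (shift c a)
  arc-path {E} c a zero _ = subst (λ z → Star (AdjIn E) (shift c z) (shift c a)) (sym (+-identityʳ a)) ε
  arc-path {E} c a (suc t) present = subst (λ z → Star (AdjIn E) (shift c z) (shift c a)) (sym (+-suc a t))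
    (edge ◅ arc-path c a t (present ∘ m<n⇒m<1+n))
    where
    edge : AdjIn E (shift c (suc (a + t))) (shift c (a + t))
    edge = shift c (a + t) , present ≤-refl , inj₂ (sym (next-shift c (a + t)) , refl)

  full-connected : IsConnectedSubgraph (⊤ , ⊤)
  full-connected = (λ _ _ → ∈⊤ , ∈⊤) , (Data.Fin.zero , ∈⊤) , λ x y _ _ →
    subst₂ (Star (AdjIn ⊤)) (shift-offset y x) (shift-zero y) (arc-path y 0 (offset y x) λ _ → ∈⊤)

  -- Deleting the edges at offsets p … q from c isolates the vertices at offsets p + 1 … q,
  -- so these are deleted as well.
  opaque
    deleteArc : Fin N → ℕ → ℕ → SubG N
    deleteArc c p q = select (λ x → ¬? (offset c x ∈[ suc p , q ]?)) , select (λ e → ¬? (offset c e ∈[ p , q ]?))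

    vertex∈deleteArc : ∀ c p q {x} → x ∈ proj₁ (deleteArc c p q) ⇔ (¬ offset c x ∈[ suc p , q ])
    vertex∈deleteArc c p q = ∈-select (λ x → ¬? (offset c x ∈[ suc p , q ]?))

    edge∈deleteArc : ∀ c p q {e} → e ∈ proj₂ (deleteArc c p q) ⇔ (¬ offset c e ∈[ p , q ])
    edge∈deleteArc c p q = ∈-select (λ e → ¬? (offset c e ∈[ p , q ]?))

  kept-edge : ∀ {c p q t} → t < N → t < p ⊎ q < t → shift c t ∈ proj₂ (deleteArc c p q)
  kept-edge {c} {p} {q} {t} t<N outside = from (edge∈deleteArc c p q) λ o∈ →
    [ (λ t<p → <⇒≱ t<p (proj₁ (shifted o∈))) , (λ q<t → <⇒≱ q<t (proj₂ (shifted o∈))) ] outside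
    where
    shifted : offset c (shift c t) ∈[ p , q ] → t ∈[ p , q ]
    shifted = subst (_∈[ p , q ]) (offset-shift c t<N)

  base∈deleteArc : ∀ c p q → c ∈ proj₁ (deleteArc c p q)
  base∈deleteArc c p q = from (vertex∈deleteArc c p q) λ (1+p≤o , _) → n≮0 (subst (p <_) (offset-self c) 1+p≤o)

  deleteArc-connected : ∀ c p q → IsConnectedSubgraph (deleteArc c p q)
  deleteArc-connected c p q =
    endpoints , (c , base∈deleteArc c p q) , λ x y x∈S y∈S → to-c x∈S ◅◅ reverse AdjIn-sym (to-c y∈S)
    where
    S E : Subset N
    S = proj₁ (deleteArc c p q)
    E = proj₂ (deleteArc c p q)
    endpoints : ∀ e → e ∈ E → e ∈ S × next e ∈ S
    endpoints e e∈E =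
      from (vertex∈deleteArc c p q) (λ (1+p≤o , o≤q) → e∉arc (<⇒≤ 1+p≤o , o≤q)) ,
      from (vertex∈deleteArc c p q) next∉arc
      where
      e∉arc : ¬ offset c e ∈[ p , q ]
      e∉arc = to (edge∈deleteArc c p q) e∈E
      next∉arc : ¬ offset c (next e) ∈[ suc p , q ]
      next∉arc (1+p≤o′ , o′≤q) with offset-next c e
      ... | inj₁ eq = e∉arc (s≤s⁻¹ (subst (suc p ≤_) eq 1+p≤o′) , ≤-trans (n≤1+n _) (subst (_≤ q) eq o′≤q))
      ... | inj₂ (_ , eq) = n≮0 (subst (p <_) eq 1+p≤o′)
    to-c : ∀ {x} → x ∈ S → Star (AdjIn E) x c
    to-c {x} x∈S with offset c x ≤? p
    ... | yes o≤p = subst₂ (Star (AdjIn E)) (shift-offset c x) (shift-zero c)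
                      (arc-path c 0 (offset c x) λ i<o → kept-edge (<-trans i<o (offset<N c x)) (inj₁ (<-≤-trans i<o o≤p)))
    ... | no o≰p = reverse AdjIn-sym (subst₂ (Star (AdjIn E)) end≡c (shift-offset c x) (arc-path c o (N ∸ o) kept))
      where
      o : ℕ
      o = offset c x
      o+[N∸o]≡N : o + (N ∸ o) ≡ N
      o+[N∸o]≡N = m+[n∸m]≡n (<⇒≤ (offset<N c x))
      end≡c : shift c (o + (N ∸ o)) ≡ c
      end≡c = trans (cong (shift c) o+[N∸o]≡N) (shift-N c)
      q<o : q < o
      q<o = ≰⇒> λ o≤q → to (vertex∈deleteArc c p q) x∈S (≰⇒> o≰p , o≤q)
      kept : ∀ {i} → i < N ∸ o → shift c (o + i) ∈ E
      kept {i} i<N∸o =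
        kept-edge {p = p} (subst (o + i <_) o+[N∸o]≡N (+-monoʳ-< o i<N∸o)) (inj₂ (<-≤-trans q<o (m≤m+n o i)))

  deleteArc-contains : ∀ {c w p q} → q < offset c w → ConnSubContaining c w (deleteArc c p q)
  deleteArc-contains {c} {w} {p} {q} q<w =
    deleteArc-connected c p q , base∈deleteArc c p q ,
    from (vertex∈deleteArc c p q) (λ (_ , w≤q) → <⇒≱ q<w w≤q)

  deleteArc-transfer : ∀ {c p q c′ p′ q′ e} → deleteArc c p q ≡ deleteArc c′ p′ q′
    → offset c e ∈[ p , q ] → offset c′ e ∈[ p′ , q′ ]
  deleteArc-transfer {c} {p} {q} {c′} {p′} {q′} eq e∈arc = decidable-stable (_ ∈[ p′ , q′ ]?) λ e∉arc′ →
    to (edge∈deleteArc c p q) (subst (_ ∈_) (sym (cong proj₂ eq)) (from (edge∈deleteArc c′ p′ q′) e∉arc′)) e∈arc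

  deleteArc-injective : ∀ {c p q p′ q′} → p ≤ q → q < N → p′ ≤ q′ → q′ < N
    → deleteArc c p q ≡ deleteArc c p′ q′ → (p , q) ≡ (p′ , q′)
  deleteArc-injective {c} p≤q q<N p′≤q′ q′<N eq =
    uncurry (cong₂ _,_) (∈[]-injective p≤q p′≤q′ (along eq q<N) (along (sym eq) q′<N))
    where
    along : ∀ {p q p′ q′} → deleteArc c p q ≡ deleteArc c p′ q′ → q < N
      → ∀ {t} → t ∈[ p , q ] → t ∈[ p′ , q′ ]
    along {p} {q} {p′} {q′} eq q<N {t} t∈ =
      subst (_∈[ p′ , q′ ]) (offset-shift c t<N) (deleteArc-transfer eq (subst (_∈[ p , q ]) (sym (offset-shift c t<N)) t∈))
      where
      t<N : t < N
      t<N = ≤-<-trans (proj₂ t∈) q<N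

  full≢deleteArc : ∀ {c p q} → p ≤ q → q < N → (⊤ , ⊤) ≢ deleteArc c p q
  full≢deleteArc {c} {p} {q} p≤q q<N eq =
    to (edge∈deleteArc c p q) (subst (shift c p ∈_) (cong proj₂ eq) ∈⊤)
      (subst (_∈[ p , q ]) (sym (offset-shift c (≤-<-trans p≤q q<N))) (≤-refl , p≤q))

  opposite-deleteArcs-distinct : ∀ {u v p q p′ q′} → u ≢ v → p ≤ q → q < offset u v → q′ < offset v u
    → deleteArc u p q ≢ deleteArc v p′ q′
  opposite-deleteArcs-distinct {u} {v} {p} {q} {p′} {q′} u≢v p≤q q<k q′<k′ eq =
    opposite-arcs-disjoint {x = shift u p} u≢v
      (subst (_< offset u v) (sym p≡) (≤-<-trans p≤q q<k)) (≤-<-trans (proj₂ moved) q′<k′)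
    where
    p≡ : offset u (shift u p) ≡ p
    p≡ = offset-shift u (≤-<-trans p≤q (<-trans q<k (offset<N u v)))
    moved : offset v (shift u p) ∈[ p′ , q′ ]
    moved = deleteArc-transfer eq (subst (_∈[ p , q ]) (sym p≡) (≤-refl , p≤q))

  all-edges⇒full : ∀ {S E : Subset N} → IsConnectedSubgraph (S , E) → (∀ e → e ∈ E) → (S , E) ≡ (⊤ , ⊤)
  all-edges⇒full (endpoints , _) all =
    cong₂ _,_ (⊆-antisym (λ {x} _ → ∈⊤ {x = x}) (λ {x} _ → proj₁ (endpoints x (all x))))
              (⊆-antisym (λ {e} _ → ∈⊤ {x = e}) (λ {e} _ → all e))

  module MissingEdge {S E : Subset N} (conn : IsConnectedSubgraph (S , E)) {c : Fin N} (c∈S : c ∈ S) where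

    private
      endpoints : ∀ {e} → e ∈ E → e ∈ S × next e ∈ S
      endpoints {e} = proj₁ conn e

      connected : ∀ {x y} → x ∈ S → y ∈ S → Star (AdjIn E) x y
      connected {x} {y} = proj₂ (proj₂ conn) x y

    Gap : ℕ → Set
    Gap t = t < N × shift c t ∉ E

    gap? : Decidable Gap
    gap? t = t <? N ×-dec ¬? (shift c t ∈? E)

    gap⇒no-edge : ∀ {t e} → Gap t → e ∈ E → offset c e ≢ t
    gap⇒no-edge {e = e} (_ , ∉E) e∈E refl = ∉E (subst (_∈ E) (sym (shift-offset c e)) e∈E)

    missing⇒gap : ∀ {e} → e ∉ E → Gap (offset c e)
    missing⇒gap {e} e∉E = offset<N c e , subst (_∉ E) (sym (shift-offset c e)) e∉E

    no-gap⇒edge : ∀ {t} → t < N → ¬ Gap t → shift c t ∈ E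
    no-gap⇒edge {t} t<N ¬gap = decidable-stable (shift c t ∈? E) λ ∉E → ¬gap (t<N , ∉E)

    Between : ℕ → ℕ → Fin N → Set
    Between o₁ o₂ x = o₁ < offset c x × offset c x ≤ o₂

    edge-preserves-between : ∀ {o₁ o₂ e} → Gap o₁ → Gap o₂ → e ∈ E → Between o₁ o₂ e ⇔ Between o₁ o₂ (next e)
    edge-preserves-between {o₁} {o₂} {e} g₁ g₂ e∈E with offset-next c e
    ... | inj₁ eq = mk⇔
      (λ (o₁<o , o≤o₂) → subst (o₁ <_) (sym eq) (m<n⇒m<1+n o₁<o) ,
                         subst (_≤ o₂) (sym eq) (≤∧≢⇒< o≤o₂ (gap⇒no-edge g₂ e∈E)))
      (λ (o₁<o′ , o′≤o₂) → ≤∧≢⇒< (s≤s⁻¹ (subst (o₁ <_) eq o₁<o′)) (gap⇒no-edge g₁ e∈E ∘ sym) ,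
                           ≤-trans (n≤1+n _) (subst (_≤ o₂) eq o′≤o₂))
    ... | inj₂ (1+o≡N , eq) = mk⇔
      (λ (_ , o≤o₂) → ⊥-elim (gap⇒no-edge g₂ e∈E (≤-antisym o≤o₂ (s≤s⁻¹ (subst (o₂ <_) (sym 1+o≡N) (proj₁ g₂))))))
      (λ (o₁<0 , _) → ⊥-elim (n≮0 (subst (o₁ <_) eq o₁<0)))

    cut-off : ∀ {o₁ o₂ x} → Gap o₁ → Gap o₂ → Between o₁ o₂ x → x ∉ S
    cut-off {o₁} {o₂} g₁ g₂ between x∈S =
      n≮0 (subst (o₁ <_) (offset-self c) (proj₁ (preserved-along crossing (connected x∈S c∈S) between)))
      where
      crossing : ∀ {x y} → AdjIn E x y → Between o₁ o₂ x → Between o₁ o₂ y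
      crossing (i , i∈E , inj₁ (refl , refl)) = to (edge-preserves-between g₁ g₂ i∈E)
      crossing (i , i∈E , inj₂ (refl , refl)) = from (edge-preserves-between g₁ g₂ i∈E)

    gap-convex : ∀ {r s t} → r < s → s < t → Gap r → Gap t → Gap s
    gap-convex {r} {s} {t} r<s s<t gr gt with gap? s
    ... | yes gs = gs
    ... | no ¬gs = ⊥-elim (cut-off gr gt between (proj₁ (endpoints (no-gap⇒edge s<N ¬gs))))
      where
      s<N : s < N
      s<N = <-trans s<t (proj₁ gt)
      between : Between r t (shift c s)
      between = subst (r <_) (sym (offset-shift c s<N)) r<s , subst (_≤ t) (sym (offset-shift c s<N)) (<⇒≤ s<t)

    gap-bounded : ∀ {w t₀} → w ∈ S → Gap t₀ → t₀ < offset c w → ∀ {t} → Gap t → t < offset c w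
    gap-bounded w∈S g₀ t₀<w gt = ≰⇒> λ w≤t → cut-off g₀ gt (t₀<w , w≤t) w∈S

    shift∈S : ∀ {p q} → (∀ {t} → Gap t → t ∈[ p , q ]) → ∀ {o} → o < N → o ≤ p → shift c o ∈ S
    shift∈S _ {zero} _ _ = subst (_∈ S) (sym (shift-zero c)) c∈S
    shift∈S gaps∈ {suc t} 1+t<N 1+t≤p =
      subst (_∈ S) (next-shift c t) (proj₂ (endpoints edge))
      where
      edge : shift c t ∈ E
      edge = no-gap⇒edge (<-trans (n<1+n t) 1+t<N) λ gt → <⇒≱ 1+t≤p (proj₁ (gaps∈ gt))

    outside⇒∈S : ∀ {p q x} → (∀ {t} → Gap t → t ∈[ p , q ]) → ¬ offset c x ∈[ suc p , q ] → x ∈ S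
    outside⇒∈S {p} {x = x} gaps∈ x∉ with offset c x ≤? p
    ... | yes o≤p = subst (_∈ S) (shift-offset c x) (shift∈S gaps∈ (offset<N c x) o≤p)
    ... | no o≰p = proj₁ (endpoints (subst (_∈ E) (shift-offset c x)
                     (no-gap⇒edge (offset<N c x) λ gap → x∉ (≰⇒> o≰p , proj₂ (gaps∈ gap)))))

    missing-edge⇒deleteArc : ∀ {w e} → w ∈ S → e ∉ E → offset c e < offset c w
      → ∃₂ λ p q → p ≤ q × q < offset c w × (S , E) ≡ deleteArc c p q
    missing-edge⇒deleteArc {w} {e} w∈S e∉E e<w
      with convex⇒interval gap? (offset c w) (gap-bounded w∈S (missing⇒gap e∉E) e<w) gap-convex (missing⇒gap e∉E)
    ... | p , q , p≤q , gaps =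
      p , q , p≤q , gap-bounded w∈S (missing⇒gap e∉E) e<w gap-q ,
      cong₂ _,_ (⊆-antisym S⊆ (λ x∈ → outside⇒∈S (to (gaps _)) (to (vertex∈deleteArc c p q) x∈)))
                (⊆-antisym E⊆ ⊆E)
      where
      gap-p : Gap p
      gap-p = from (gaps p) (≤-refl , p≤q)
      gap-q : Gap q
      gap-q = from (gaps q) (p≤q , ≤-refl)
      S⊆ : S ⊆ proj₁ (deleteArc c p q)
      S⊆ x∈S = from (vertex∈deleteArc c p q) λ x∈arc → cut-off gap-p gap-q x∈arc x∈S
      E⊆ : E ⊆ proj₂ (deleteArc c p q)
      E⊆ e∈E = from (edge∈deleteArc c p q) λ e∈arc → gap⇒no-edge (from (gaps _) e∈arc) e∈E refl
      ⊆E : proj₂ (deleteArc c p q) ⊆ E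
      ⊆E {e′} e′∈ = subst (_∈ E) (shift-offset c e′)
        (no-gap⇒edge (offset<N c e′) λ gap → to (edge∈deleteArc c p q) e′∈ (to (gaps _) gap))

  arcs : Fin N → ℕ → List (SubG N)
  arcs c K = map (uncurry (deleteArc c)) (orderedPairs K)

  ∈-arcs : ∀ {c K G} → G List.∈ arcs c K ⇔ (∃₂ λ p q → p ≤ q × q < K × G ≡ deleteArc c p q)
  ∈-arcs {c} {K} = mk⇔ unpack pack
    where
    pack : ∀ {G} → (∃₂ λ p q → p ≤ q × q < K × G ≡ deleteArc c p q) → G List.∈ arcs c K
    pack (_ , _ , p≤q , q<K , refl) = ∈-map⁺ (uncurry (deleteArc c)) (∈-orderedPairs⁺ p≤q q<K)
    unpack : ∀ {G} → G List.∈ arcs c K → ∃₂ λ p q → p ≤ q × q < K × G ≡ deleteArc c p q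
    unpack G∈ with ∈-map⁻ (uncurry (deleteArc c)) {xs = orderedPairs K} G∈
    ... | (p , q) , pq∈ , refl with ∈-orderedPairs⁻ {K} pq∈
    ...   | p≤q , q<K = p , q , p≤q , q<K , refl

  arcs-unique : ∀ {c K} → K ≤ N → Unique (arcs c K)
  arcs-unique {c} {K} K≤N = map⁺-injectiveOn injective (orderedPairs-unique K)
    where
    injective : ∀ {x y} → x List.∈ orderedPairs K → y List.∈ orderedPairs K
      → uncurry (deleteArc c) x ≡ uncurry (deleteArc c) y → x ≡ y
    injective x∈ y∈ with ∈-orderedPairs⁻ {K} x∈ | ∈-orderedPairs⁻ {K} y∈
    ... | p≤q , q<K | p′≤q′ , q′<K = deleteArc-injective p≤q (<-≤-trans q<K K≤N) p′≤q′ (<-≤-trans q′<K K≤N)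

  length-arcs : ∀ c K → 2 * length (arcs c K) ≡ K * suc K
  length-arcs c K = trans (cong (2 *_) (length-map (uncurry (deleteArc c)) (orderedPairs K))) (length-orderedPairs K)

  module Count {u v : Fin N} (u≢v : u ≢ v) where

    k k′ : ℕ
    k = offset u v
    k′ = offset v u

    candidates : List (SubG N)
    candidates = (⊤ , ⊤) ∷ arcs u k ++ arcs v k′

    candidates-unique : Unique candidates
    candidates-unique =
      All.tabulate full∉ ∷ Unique.++⁺ (arcs-unique (<⇒≤ (offset<N u v))) (arcs-unique (<⇒≤ (offset<N v u))) disjoint
      where
      full∉ : ∀ {G} → G List.∈ arcs u k ++ arcs v k′ → (⊤ , ⊤) ≢ G
      full∉ G∈ with ∈-++⁻ (arcs u k) G∈
      ... | inj₁ G∈u with to ∈-arcs G∈u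
      ...   | _ , _ , p≤q , q<k , refl = full≢deleteArc p≤q (<-trans q<k (offset<N u v))
      full∉ G∈ | inj₂ G∈v with to ∈-arcs G∈v
      ...   | _ , _ , p≤q , q<k′ , refl = full≢deleteArc p≤q (<-trans q<k′ (offset<N v u))
      disjoint : ∀ {G} → ¬ (G List.∈ arcs u k × G List.∈ arcs v k′)
      disjoint (G∈u , G∈v) with to ∈-arcs G∈u | to ∈-arcs G∈v
      ... | _ , _ , p≤q , q<k , refl | _ , _ , _ , q′<k′ , eq = opposite-deleteArcs-distinct u≢v p≤q q<k q′<k′ eq

    candidate⇒connected : ∀ {G} → G List.∈ candidates → ConnSubContaining u v G
    candidate⇒connected (here refl) = full-connected , ∈⊤ , ∈⊤
    candidate⇒connected (there G∈) with ∈-++⁻ (arcs u k) G∈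
    ... | inj₁ G∈u with to ∈-arcs G∈u
    ...   | _ , _ , _ , q<k , refl = deleteArc-contains q<k
    candidate⇒connected (there G∈) | inj₂ G∈v with to ∈-arcs G∈v
    ...   | _ , _ , _ , q<k′ , refl with deleteArc-contains q<k′
    ...     | connected , v∈ , u∈ = connected , u∈ , v∈

    connected⇒candidate : ∀ {G} → ConnSubContaining u v G → G List.∈ candidates
    connected⇒candidate {S , E} (conn , u∈S , v∈S) with all? (_∈? E)
    ... | yes all = here (all-edges⇒full conn all)
    ... | no ¬all with ¬∀⟶∃¬ N (_∈ E) (_∈? E) ¬all
    ...   | e , e∉E with offset u e <? k
    ...     | yes e<v = there (∈-++⁺ˡ (from ∈-arcs (MissingEdge.missing-edge⇒deleteArc conn u∈S v∈S e∉E e<v)))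
    ...     | no e≮v = there (∈-++⁺ʳ (arcs u k) (from ∈-arcs
                         (MissingEdge.missing-edge⇒deleteArc conn v∈S u∈S e∉E (other-arc u≢v (≮⇒≥ e≮v)))))

    enumeration-length : ∀ {L} → Enumerates u v L → 2 * length L ≡ 2 + (k * suc k + k′ * suc k′)
    enumeration-length {L} (L-unique , enumerates) = begin
      2 * length L
        ≡⟨ cong (2 *_) (unique⇒length≡ L-unique candidates-unique same-members) ⟩
      2 * suc (length (arcs u k ++ arcs v k′))
        ≡⟨ *-suc 2 _ ⟩
      2 + 2 * length (arcs u k ++ arcs v k′)
        ≡⟨ cong (λ z → 2 + 2 * z) (length-++ (arcs u k)) ⟩
      2 + 2 * (length (arcs u k) + length (arcs v k′))
        ≡⟨ cong (2 +_) (*-distribˡ-+ 2 (length (arcs u k)) _) ⟩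
      2 + (2 * length (arcs u k) + 2 * length (arcs v k′))
        ≡⟨ cong₂ (λ a b → 2 + (a + b)) (length-arcs u k) (length-arcs v k′) ⟩
      2 + (k * suc k + k′ * suc k′) ∎
      where
      open ≡-Reasoning
      same-members : ∀ {G} → G List.∈ L ⇔ G List.∈ candidates
      same-members {G} = mk⇔ (connected⇒candidate ∘ to (enumerates G)) (from (enumerates G) ∘ candidate⇒connected)

-- The hypothesis 3 ≤ n is used only to exclude n = 0: the argument works on every cycle.
lemma3p2 : (n : ℕ) → 3 ≤ n → (u v : Fin n) → ¬ u ≡ v → (L : List (SubG n)) → Enumerates u v L → (d : ℕ) → IsDistance u v d
    → (n * n + 2 * n + 4 ≤ 4 * length L)
      × (2 * length L ≤ n * n ∸ n + 4)
      × ((4 * length L ≡ n * n + 2 * n + 4) ⇔ (2 * d ≡ n))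
      × ((2 * length L ≡ n * n ∸ n + 4) ⇔ (d ≡ 1))
lemma3p2 (suc m) _ u v u≢v L enumerates d distance =
  subst (λ n → CountBounds n (length L) d) (offset-sum u≢v)
    (count-bounds {F = length L} (offset-pos u≢v) (offset-pos (u≢v ∘ sym)) (distance≡min u≢v distance)
                  (Count.enumeration-length u≢v enumerates))
  where open Cycle m
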